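{- Let $a_1,a_2,a_3$ be arbitrary nonzero integers, let $p_1,p_2,q_1,q_2,r_1,r_2,r_3$ be arbitrary integers, and let $\lambda,\mu$ be arbitrary rational numbers. Define \[ \begin{aligned} f_1&=\lambda p_1p_2r_1(q_1+q_2), & g_1&=-\mu a_2a_3r_2^3r_3^3(p_1+p_2),\\ f_2&=\lambda p_1q_2r_2(p_1+p_2), & g_2&=\mu a_1a_3p_2r_1^3r_3^3,\\ f_3&=\lambda p_2q_1r_3(p_1+p_2), & g_3&=\mu a_1a_2p_1r_1^3r_2^3, \end{aligned} \] \[ u=\sum_{i=1}^3 a_i g_i r_i(3f_i^2+g_i^2),\qquad v=-\sum_{i=1}^3 a_i f_i g_i(f_i^2+g_i^2), \] and $x_i=(f_i+g_i)u+r_iv$, $y_i=(f_i-g_i)u+r_iv$ for $i=1,2,3$. Then \[ a_1x_1^4+a_2x_2^4+a_3x_3^4=a_1y_1^4+a_2y_2^4+a_3y_3^4 . \] -}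

module Defs where

open import Data.Integer.Base as ℤ using (ℤ)
open import Data.Rational.Base using (ℚ; _+_; _*_; -_; _/_; 1ℚ)

ι : ℤ → ℚ
ι z = z / 1

_² : ℚ → ℚ
x ² = x * x

_³ : ℚ → ℚ
x ³ = x * x * x

_⁴ : ℚ → ℚ
x ⁴ = (x * x) * (x * x)

sum3 : ℚ → ℚ → ℚ → ℚ
sum3 x y z = x + y + z

module Construction (a₁ a₂ a₃ p₁ p₂ q₁ q₂ r₁ r₂ r₃ : ℤ) (λ' μ : ℚ) where
  A₁ A₂ A₃ P₁ P₂ Q₁ Q₂ R₁ R₂ R₃ : ℚ
  A₁ = ι a₁
  A₂ = ι a₂
  A₃ = ι a₃
  P₁ = ι p₁
  P₂ = ι p₂
  Q₁ = ι q₁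
  Q₂ = ι q₂
  R₁ = ι r₁
  R₂ = ι r₂
  R₃ = ι r₃

  f₁ f₂ f₃ g₁ g₂ g₃ : ℚ
  f₁ = λ' * P₁ * P₂ * R₁ * (Q₁ + Q₂)
  f₂ = λ' * P₁ * Q₂ * R₂ * (P₁ + P₂)
  f₃ = λ' * P₂ * Q₁ * R₃ * (P₁ + P₂)
  g₁ = - (μ * A₂ * A₃ * (R₂ ³) * (R₃ ³) * (P₁ + P₂))
  g₂ = μ * A₁ * A₃ * P₂ * (R₁ ³) * (R₃ ³)
  g₃ = μ * A₁ * A₂ * P₁ * (R₁ ³) * (R₂ ³)

  3ℚ : ℚ
  3ℚ = ι (ℤ.+ 3)

  uterm vterm : ℚ → ℚ → ℚ → ℚ → ℚ
  uterm a f g r = a * g * r * (3ℚ * (f ²) + g ²)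
  vterm a f g r = a * f * g * (f ² + g ²)

  u v : ℚ
  u = sum3 (uterm A₁ f₁ g₁ R₁) (uterm A₂ f₂ g₂ R₂) (uterm A₃ f₃ g₃ R₃)
  v = - sum3 (vterm A₁ f₁ g₁ R₁) (vterm A₂ f₂ g₂ R₂) (vterm A₃ f₃ g₃ R₃)

  x y : ℚ → ℚ → ℚ → ℚ
  x f g r = (f + g) * u + r * v
  y f g r = (f + (- g)) * u + r * v

  x₁ x₂ x₃ y₁ y₂ y₃ : ℚ
  x₁ = x f₁ g₁ R₁
  x₂ = x f₂ g₂ R₂
  x₃ = x f₃ g₃ R₃
  y₁ = y f₁ g₁ R₁
  y₂ = y f₂ g₂ R₂
  y₃ = y f₃ g₃ R₃

  lhs rhs : ℚ
  lhs = A₁ * (x₁ ⁴) + A₂ * (x₂ ⁴) + A₃ * (x₃ ⁴)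
  rhs = A₁ * (y₁ ⁴) + A₂ * (y₂ ⁴) + A₃ * (y₃ ⁴)

module Submission where

-- Put X = f u + r v, so that x = X + g u and y = X − g u.
-- Then x⁴ − y⁴ = 8 g u X (X² + g² u²), and expanding in u and v gives, for each
-- index i,
--   a x⁴ − a y⁴ = 8u (u³ V + u² v U + 3 u v² C + v³ D)
-- with V = a f g (f² + g²) and U = a g r (3f² + g²) the summands defining
-- v and u, C = a f g r² and D = a g r³.  This correction term is linear in
-- (U, V, C, D), so summed over i it becomes the correction built from the
-- sums ΣU = u, ΣV = −v, ΣC and ΣD.  The first two contributions cancel
-- (u³(−v) + u² v u = 0), and the particular f_i, g_i of the construction are
-- chosen exactly so that ΣC = 0 and ΣD = 0.  Hence the three corrections sum
-- to 0 and lhs = rhs.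
--
-- Since the solver only recognises
-- +, * and -, these lemmas are stated with explicit products (using `let` for
-- readability); they are definitionally the forms with ², ³, ⁴, `correction`,
-- `cterm`, `dterm` used afterwards.

open import Defs
open import Data.Integer.Base using (ℤ; 0ℤ) renaming (+_ to +ℤ_)
open import Data.Rational.Base using (ℚ; _+_; _*_; -_; 0ℚ)
open import Data.Rational.Properties using (_≟_; +-*-commutativeRing; +-identityʳ)
open import Level using (0ℓ)
open import Relation.Nullary.Decidable.Core using (dec⇒maybe)
open import Relation.Binary.PropositionalEquality using (_≡_; _≢_; cong; cong₂; module ≡-Reasoning)
open import Tactic.RingSolver using (solve-∀)
open import Tactic.RingSolver.Core.AlmostCommutativeRing using (AlmostCommutativeRing; fromCommutativeRing)

-- ℚ as a ring for the reflective solver, with decidable zero test so that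
-- vanishing coefficients are discarded during normalisation.
ℚ-ring : AlmostCommutativeRing 0ℓ 0ℓ
ℚ-ring = fromCommutativeRing +-*-commutativeRing (λ x → dec⇒maybe (0ℚ ≟ x))

three eight : ℚ
three = ι (+ℤ 3)
eight = ι (+ℤ 8)

cterm : (a f g r : ℚ) → ℚ
cterm a f g r = a * f * g * (r * r)

dterm : (a g r : ℚ) → ℚ
dterm a g r = a * g * (r * r * r)

correction : (u v U V C D : ℚ) → ℚ
correction u v U V C D =
  eight * u * (u * u * u * V + u * u * v * U + three * u * v * v * C + v * v * v * D)

-- Per-index identity: a x⁴ = a y⁴ + correction u v U V (cterm a f g r) (dterm a g r)
-- for x, y = (f ± g) u + r v; it comes from x⁴ − y⁴ = 8 g u X (X² + g² u²).
quartic-split : ∀ a f g r u v →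
  let x = (f + g) * u + r * v
      y = (f + - g) * u + r * v
      U = a * g * r * (three * (f * f) + g * g)
      V = a * f * g * (f * f + g * g)
  in a * ((x * x) * (x * x))
     ≡ a * ((y * y) * (y * y))
       + eight * u * (u * u * u * V + u * u * v * U
                      + three * u * v * v * (a * f * g * (r * r)) + v * v * v * (a * g * (r * r * r)))
quartic-split = solve-∀ ℚ-ring

correction-additive : ∀ u v U₁ V₁ C₁ D₁ U₂ V₂ C₂ D₂ U₃ V₃ C₃ D₃ →
  let corr U V C D = eight * u * (u * u * u * V + u * u * v * U + three * u * v * v * C + v * v * v * D)
  in corr U₁ V₁ C₁ D₁ + corr U₂ V₂ C₂ D₂ + corr U₃ V₃ C₃ D₃
     ≡ corr (U₁ + U₂ + U₃) (V₁ + V₂ + V₃) (C₁ + C₂ + C₃) (D₁ + D₂ + D₃)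
correction-additive = solve-∀ ℚ-ring

correction-vanishes : ∀ u s →
  eight * u * (u * u * u * s + u * u * (- s) * u + three * u * (- s) * (- s) * 0ℚ + (- s) * (- s) * (- s) * 0ℚ)
  ≡ 0ℚ
correction-vanishes = solve-∀ ℚ-ring

sum-interchange : ∀ Y₁ Y₂ Y₃ E₁ E₂ E₃ →
  (Y₁ + E₁) + (Y₂ + E₂) + (Y₃ + E₃) ≡ (Y₁ + Y₂ + Y₃) + (E₁ + E₂ + E₃)
sum-interchange = solve-∀ ℚ-ring

side-condition-D : ∀ a₁ a₂ a₃ p₁ p₂ r₁ r₂ r₃ μ →
  let g₁ = - (μ * a₂ * a₃ * (r₂ * r₂ * r₂) * (r₃ * r₃ * r₃) * (p₁ + p₂))
      g₂ = μ * a₁ * a₃ * p₂ * (r₁ * r₁ * r₁) * (r₃ * r₃ * r₃)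
      g₃ = μ * a₁ * a₂ * p₁ * (r₁ * r₁ * r₁) * (r₂ * r₂ * r₂)
  in a₁ * g₁ * (r₁ * r₁ * r₁) + a₂ * g₂ * (r₂ * r₂ * r₂) + a₃ * g₃ * (r₃ * r₃ * r₃) ≡ 0ℚ
side-condition-D = solve-∀ ℚ-ring

side-condition-C : ∀ a₁ a₂ a₃ p₁ p₂ q₁ q₂ r₁ r₂ r₃ λ' μ →
  let f₁ = λ' * p₁ * p₂ * r₁ * (q₁ + q₂)
      f₂ = λ' * p₁ * q₂ * r₂ * (p₁ + p₂)
      f₃ = λ' * p₂ * q₁ * r₃ * (p₁ + p₂)
      g₁ = - (μ * a₂ * a₃ * (r₂ * r₂ * r₂) * (r₃ * r₃ * r₃) * (p₁ + p₂))
      g₂ = μ * a₁ * a₃ * p₂ * (r₁ * r₁ * r₁) * (r₃ * r₃ * r₃)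
      g₃ = μ * a₁ * a₂ * p₁ * (r₁ * r₁ * r₁) * (r₂ * r₂ * r₂)
  in a₁ * f₁ * g₁ * (r₁ * r₁) + a₂ * f₂ * g₂ * (r₂ * r₂) + a₃ * f₃ * g₃ * (r₃ * r₃) ≡ 0ℚ
side-condition-C = solve-∀ ℚ-ring

module _ (a₁ a₂ a₃ p₁ p₂ q₁ q₂ r₁ r₂ r₃ : ℤ) (λ' μ : ℚ) where
  open Construction a₁ a₂ a₃ p₁ p₂ q₁ q₂ r₁ r₂ r₃ λ' μ
  open ≡-Reasoning

  excess : (a f g r : ℚ) → ℚ
  excess a f g r = correction u v (uterm a f g r) (vterm a f g r) (cterm a f g r) (dterm a g r)

  index-identity : ∀ a f g r → a * (x f g r ⁴) ≡ a * (y f g r ⁴) + excess a f g r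
  index-identity a f g r = quartic-split a f g r u v

  excesses-cancel : excess A₁ f₁ g₁ R₁ + excess A₂ f₂ g₂ R₂ + excess A₃ f₃ g₃ R₃ ≡ 0ℚ
  excesses-cancel = begin
    excess A₁ f₁ g₁ R₁ + excess A₂ f₂ g₂ R₂ + excess A₃ f₃ g₃ R₃
      ≡⟨ correction-additive u v (uterm A₁ f₁ g₁ R₁) (vterm A₁ f₁ g₁ R₁) (cterm A₁ f₁ g₁ R₁) (dterm A₁ g₁ R₁)
                                 (uterm A₂ f₂ g₂ R₂) (vterm A₂ f₂ g₂ R₂) (cterm A₂ f₂ g₂ R₂) (dterm A₂ g₂ R₂)
                                 (uterm A₃ f₃ g₃ R₃) (vterm A₃ f₃ g₃ R₃) (cterm A₃ f₃ g₃ R₃) (dterm A₃ g₃ R₃) ⟩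
    correction u v u ΣV ΣC ΣD
      ≡⟨ cong₂ (correction u v u ΣV) (side-condition-C A₁ A₂ A₃ P₁ P₂ Q₁ Q₂ R₁ R₂ R₃ λ' μ)
                                     (side-condition-D A₁ A₂ A₃ P₁ P₂ R₁ R₂ R₃ μ) ⟩
    correction u v u ΣV 0ℚ 0ℚ
      ≡⟨ correction-vanishes u ΣV ⟩
    0ℚ ∎
    where
    -- v is by definition −ΣV
    ΣV ΣC ΣD : ℚ
    ΣV = vterm A₁ f₁ g₁ R₁ + vterm A₂ f₂ g₂ R₂ + vterm A₃ f₃ g₃ R₃
    ΣC = cterm A₁ f₁ g₁ R₁ + cterm A₂ f₂ g₂ R₂ + cterm A₃ f₃ g₃ R₃
    ΣD = dterm A₁ g₁ R₁ + dterm A₂ g₂ R₂ + dterm A₃ g₃ R₃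

  lhs≡rhs : lhs ≡ rhs
  lhs≡rhs = begin
    lhs
      ≡⟨ cong₂ _+_ (cong₂ _+_ (index-identity A₁ f₁ g₁ R₁) (index-identity A₂ f₂ g₂ R₂))
                   (index-identity A₃ f₃ g₃ R₃) ⟩
    (A₁ * y₁ ⁴ + excess A₁ f₁ g₁ R₁) + (A₂ * y₂ ⁴ + excess A₂ f₂ g₂ R₂) + (A₃ * y₃ ⁴ + excess A₃ f₃ g₃ R₃)
      ≡⟨ sum-interchange (A₁ * y₁ ⁴) (A₂ * y₂ ⁴) (A₃ * y₃ ⁴)
                         (excess A₁ f₁ g₁ R₁) (excess A₂ f₂ g₂ R₂) (excess A₃ f₃ g₃ R₃) ⟩
    rhs + (excess A₁ f₁ g₁ R₁ + excess A₂ f₂ g₂ R₂ + excess A₃ f₃ g₃ R₃)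
      ≡⟨ cong (rhs +_) excesses-cancel ⟩
    rhs + 0ℚ
      ≡⟨ +-identityʳ rhs ⟩
    rhs ∎

-- The identity is polynomial and holds without the hypotheses a_i ≠ 0.
mainTheorem2 : (a₁ a₂ a₃ : ℤ) → a₁ ≢ 0ℤ → a₂ ≢ 0ℤ → a₃ ≢ 0ℤ →
               (p₁ p₂ q₁ q₂ r₁ r₂ r₃ : ℤ) → (λ' μ : ℚ) →
               Construction.lhs a₁ a₂ a₃ p₁ p₂ q₁ q₂ r₁ r₂ r₃ λ' μ
                 ≡ Construction.rhs a₁ a₂ a₃ p₁ p₂ q₁ q₂ r₁ r₂ r₃ λ' μ
mainTheorem2 a₁ a₂ a₃ _ _ _ = lhs≡rhs a₁ a₂ a₃
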